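{- For the complete graph $K_n$ on $n\ge1$ vertices, \[ \mathrm{pn}(K_n)=\frac{n!}{2}\sum_{k=0}^{n-1}\frac1{k!}+\frac n2 . \]
   Context: For a graph $G$, the subpath number $\mathrm{pn}(G)$ is the number of paths (as subgraphs, i.e. unordered) in $G$, including the trivial paths of length $0$ (single vertices). -}

module Defs where

open import Data.Nat using (ℕ; zero; suc; _+_; _<_)
open import Data.Bool using (Bool; true; false; not; _∧_)
open import Data.Fin using (Fin; toℕ)
open import Data.Fin.Properties using (_≟_)
open import Data.List using (List; []; _∷_; allFin; concatMap; map; filter; length; upTo; last)
open import Data.Nat.ListAction using (sum)
open import Data.Maybe using (Maybe; just; nothing)
open import Data.Product using (_×_; _,_)
open import Relation.Nullary using (Dec; yes; no; ¬_)
open import Relation.Nullary.Decidable using (⌊_⌋)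
open import Relation.Binary.PropositionalEquality using (_≡_)

record Graph (n : ℕ) : Set where
  field
    adj       : Fin n → Fin n → Bool
    symmetric : ∀ u v → adj u v ≡ adj v u
    irrefl    : ∀ v → adj v v ≡ false
open Graph public

K : (n : ℕ) → Graph n
K n = record { adj = λ u v → not ⌊ u ≟ v ⌋ ; symmetric = sym' ; irrefl = irr }
  where
  open import Relation.Binary.PropositionalEquality using (refl; sym)
  sym' : ∀ u v → not ⌊ u ≟ v ⌋ ≡ not ⌊ v ≟ u ⌋
  sym' u v with u ≟ v | v ≟ u
  ... | yes _ | yes _ = refl
  ... | no _  | no _  = refl
  ... | yes p | no q  = Data.Empty.⊥-elim (q (sym p)) where import Data.Empty
  ... | no p  | yes q = Data.Empty.⊥-elim (p (sym q)) where import Data.Empty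
  irr : ∀ v → not ⌊ v ≟ v ⌋ ≡ false
  irr v with v ≟ v
  ... | yes _ = refl
  ... | no ¬p = Data.Empty.⊥-elim (¬p refl) where import Data.Empty

seqs : (n k : ℕ) → List (List (Fin n))
seqs n zero    = [] ∷ []
seqs n (suc k) = concatMap (λ v → map (v ∷_) (seqs n k)) (allFin n)

notIn : ∀ {n} → Fin n → List (Fin n) → Bool
notIn v []       = true
notIn v (x ∷ xs) = not ⌊ v ≟ x ⌋ ∧ notIn v xs

isPathSeq : ∀ {n} → Graph n → List (Fin n) → Bool
isPathSeq G []           = true
isPathSeq G (x ∷ [])     = true
isPathSeq G (x ∷ y ∷ xs) = adj G x y ∧ notIn x (y ∷ xs) ∧ isPathSeq G (y ∷ xs)

-- A path subgraph P with ≥ 1 vertex corresponds to exactly two vertex sequences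
-- (one per direction) if it has ≥ 2 vertices, and one sequence if it is a single
-- vertex.
canonical : ∀ {n} → List (Fin n) → Bool
canonical []           = false
canonical (x ∷ [])     = true
canonical (x ∷ y ∷ xs) with last (y ∷ xs)
... | just z  = ⌊ toℕ x Data.Nat.<? toℕ z ⌋ where import Data.Nat
... | nothing = false

pathsOfOrder : ∀ {n} → Graph n → ℕ → List (List (Fin n))
pathsOfOrder {n} G k =
  filter (λ xs → Data.Bool._≟_ (canonical xs ∧ isPathSeq G xs) true) (seqs n k)
  where import Data.Bool

-- Subpath number: number of paths in G (as unordered subgraphs), including
-- trivial one-vertex paths.  A path has at most n vertices.
pn : ∀ {n} → Graph n → ℕ
pn {n} G = sum (map (λ k → length (pathsOfOrder G (suc k))) (upTo n))

-- A vertex sequence of K_n is a path exactly when its vertices are distinct, and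
-- appending a vertex to a distinct sequence of length k leaves n ∸ k choices, so
-- there are n P′ k = n!/(n-k)! such sequences of length k.  A path on k ≥ 2
-- vertices has two vertex sequences, each the reverse of the other, and since its
-- ends differ exactly one of them is canonical; a one-vertex path has one.  Hence
-- 2 pn(K_n) = 2n + Σ_{k=2}^{n} n!/(n-k)! = n + Σ_{j=0}^{n-1} n!/j!.

module Submission where

open import Defs
open import Data.Nat using (ℕ; _+_; _*_; _≤_; _!)
open import Data.Nat.DivMod using (_/_)
open import Data.Nat.Properties using (_!≢0)
open import Data.List using (map; upTo)
open import Data.Nat.ListAction using (sum)
open import Relation.Binary.PropositionalEquality using (_≡_)

open import Algebra.Bundles using (CommutativeMonoid)
open import Data.Bool using (Bool; true; false; not; _∧_)
import Data.Bool as Bool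
open import Data.Bool.Properties
  using (∧-commutativeMonoid; ∧-assoc; ∧-comm; ∧-zeroʳ; ∧-identityʳ; ∧-conicalˡ; ∧-conicalʳ)
open import Data.Empty using (⊥-elim)
open import Data.Fin using (Fin; toℕ; opposite) renaming (zero to fzero; suc to fsuc)
open import Data.Fin.Permutation using (reverse)
open import Data.Fin.Properties using (_≟_; toℕ-injective; toℕ<n; opposite-prop)
open import Data.List
  using (List; []; _∷_; _++_; _∷ʳ_; allFin; applyUpTo; concatMap; filter; last; length; tabulate)
  renaming (reverse to rev)
open import Data.List.Properties using (map-++; map-∘; reverse-++; unfold-reverse)
open import Data.Maybe using (just)
open import Data.Nat using (zero; suc; _∸_)
open import Data.Nat.Combinatorics.Base using (_P′_)
open import Data.Nat.Combinatorics.Specification using (nP′k≡n!/[n∸k]!)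
open import Data.Nat.ListAction.Properties using (sum-++)
open import Data.Nat.Properties
  using (+-*-semiring; _<?_; <-asym; ≤-antisym; ≮⇒≥; +-comm; +-assoc; +-identityʳ;
         *-identityˡ; *-identityʳ; *-zeroʳ; m+n∸n≡m)
open import Function using (_∘_)
open import Relation.Binary.PropositionalEquality using (refl; sym; trans; cong; cong₂)
open import Relation.Nullary using (yes; no)
open import Relation.Nullary.Decidable using (⌊_⌋)
open import Algebra.Properties.CommutativeSemigroup
  (CommutativeMonoid.commutativeSemigroup ∧-commutativeMonoid)
  using (interchange)
open import Algebra.Properties.Semiring.Sum +-*-semiring
  using (sum-syntax; sum-cong-≗; sum-replicate-zero; ∑-distrib-+; ∑-comm; ∑-permute;
         *-distribˡ-sum)
open Relation.Binary.PropositionalEquality.≡-Reasoning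

private variable
  A B : Set

𝟙 : Bool → ℕ
𝟙 true  = 1
𝟙 false = 0

sum-map-applyUpTo : ∀ (f : A → ℕ) (g : ℕ → A) n →
  sum (map f (applyUpTo g n)) ≡ ∑[ i < n ] f (g (toℕ i))
sum-map-applyUpTo f g zero    = refl
sum-map-applyUpTo f g (suc n) = cong (f (g 0) +_) (sum-map-applyUpTo f (g ∘ suc) n)

sum-map-tabulate : ∀ {n} (f : A → ℕ) (g : Fin n → A) →
  sum (map f (tabulate g)) ≡ ∑[ i < n ] f (g i)
sum-map-tabulate {n = zero}  f g = refl
sum-map-tabulate {n = suc n} f g = cong (f (g fzero) +_) (sum-map-tabulate f (g ∘ fsuc))

sum-map-concatMap : ∀ (f : B → ℕ) (g : A → List B) xs →
  sum (map f (concatMap g xs)) ≡ sum (map (λ x → sum (map f (g x))) xs)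
sum-map-concatMap f g []       = refl
sum-map-concatMap f g (x ∷ xs) = begin
  sum (map f (g x ++ concatMap g xs))
    ≡⟨ cong sum (map-++ f (g x) (concatMap g xs)) ⟩
  sum (map f (g x) ++ map f (concatMap g xs))
    ≡⟨ sum-++ (map f (g x)) _ ⟩
  sum (map f (g x)) + sum (map f (concatMap g xs))
    ≡⟨ cong (sum (map f (g x)) +_) (sum-map-concatMap f g xs) ⟩
  sum (map f (g x)) + sum (map (λ x → sum (map f (g x))) xs) ∎

length-filter-≡true : ∀ (p : A → Bool) xs →
  length (filter (λ x → p x Bool.≟ true) xs) ≡ sum (map (λ x → 𝟙 (p x)) xs)
length-filter-≡true p []       = refl
length-filter-≡true p (x ∷ xs) with p x
... | true  = cong suc (length-filter-≡true p xs)
... | false = length-filter-≡true p xs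

last-∷ʳ : ∀ (xs : List A) x → last (xs ∷ʳ x) ≡ just x
last-∷ʳ []           x = refl
last-∷ʳ (y ∷ [])     x = refl
last-∷ʳ (y ∷ z ∷ xs) x = last-∷ʳ (z ∷ xs) x

reverse-∷-∷ʳ : ∀ (x : A) ms z → rev (x ∷ ms ∷ʳ z) ≡ z ∷ rev ms ∷ʳ x
reverse-∷-∷ʳ x ms z = trans (unfold-reverse x (ms ∷ʳ z)) (cong (_∷ʳ x) (reverse-++ ms (z ∷ [])))

∑-1 : ∀ n → ∑[ v < n ] 1 ≡ n
∑-1 zero    = refl
∑-1 (suc n) = cong suc (∑-1 n)

∑-≟ : ∀ {n} (x : Fin n) → ∑[ v < n ] 𝟙 ⌊ v ≟ x ⌋ ≡ 1
∑-≟ {suc n} fzero    = cong suc (sum-replicate-zero n)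
∑-≟ {suc n} (fsuc x) = trans (sum-cong-≗ (λ v → cong 𝟙 (⌊suc≟suc⌋ v))) (∑-≟ x)
  where
  ⌊suc≟suc⌋ : ∀ v → ⌊ fsuc v ≟ fsuc x ⌋ ≡ ⌊ v ≟ x ⌋
  ⌊suc≟suc⌋ v with v ≟ x
  ... | yes _ = refl
  ... | no _  = refl

∑seq : (n k : ℕ) → (List (Fin n) → ℕ) → ℕ
∑seq n zero    f = f []
∑seq n (suc k) f = ∑[ v < n ] ∑seq n k (λ xs → f (v ∷ xs))

sum-map-seqs : ∀ (n k : ℕ) (f : List (Fin n) → ℕ) → sum (map f (seqs n k)) ≡ ∑seq n k f
sum-map-seqs n zero    f = +-identityʳ (f [])
sum-map-seqs n (suc k) f = begin
  sum (map f (concatMap (λ v → map (v ∷_) (seqs n k)) (allFin n)))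
    ≡⟨ sum-map-concatMap f (λ v → map (v ∷_) (seqs n k)) (allFin n) ⟩
  sum (map (λ v → sum (map f (map (v ∷_) (seqs n k)))) (allFin n))
    ≡⟨ sum-map-tabulate (λ v → sum (map f (map (v ∷_) (seqs n k)))) (λ v → v) ⟩
  ∑[ v < n ] sum (map f (map (v ∷_) (seqs n k)))
    ≡⟨ sum-cong-≗ (λ v → trans (cong sum (sym (map-∘ (seqs n k))))
                                (sum-map-seqs n k (λ xs → f (v ∷ xs)))) ⟩
  ∑[ v < n ] ∑seq n k (λ xs → f (v ∷ xs)) ∎

∑seq-cong : ∀ (n k : ℕ) {f g : List (Fin n) → ℕ} →
  (∀ xs → length xs ≡ k → f xs ≡ g xs) → ∑seq n k f ≡ ∑seq n k g
∑seq-cong n zero    f≗g = f≗g [] refl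
∑seq-cong n (suc k) f≗g =
  sum-cong-≗ (λ v → ∑seq-cong n k (λ xs |xs|≡k → f≗g (v ∷ xs) (cong suc |xs|≡k)))

∑seq-distrib-+ : ∀ (n k : ℕ) (f g : List (Fin n) → ℕ) →
  ∑seq n k (λ xs → f xs + g xs) ≡ ∑seq n k f + ∑seq n k g
∑seq-distrib-+ n zero    f g = refl
∑seq-distrib-+ n (suc k) f g = trans
  (sum-cong-≗ (λ v → ∑seq-distrib-+ n k (λ xs → f (v ∷ xs)) (λ xs → g (v ∷ xs))))
  (∑-distrib-+ (λ v → ∑seq n k (λ xs → f (v ∷ xs))) (λ v → ∑seq n k (λ xs → g (v ∷ xs))))

*-distribˡ-∑seq : ∀ (n k : ℕ) c (f : List (Fin n) → ℕ) →
  c * ∑seq n k f ≡ ∑seq n k (λ xs → c * f xs)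
*-distribˡ-∑seq n zero    c f = refl
*-distribˡ-∑seq n (suc k) c f = trans
  (*-distribˡ-sum c (λ v → ∑seq n k (λ xs → f (v ∷ xs))))
  (sum-cong-≗ (λ v → *-distribˡ-∑seq n k c (λ xs → f (v ∷ xs))))

∑-∑seq-comm : ∀ (m n k : ℕ) (f : Fin m → List (Fin n) → ℕ) →
  ∑[ u < m ] ∑seq n k (f u) ≡ ∑seq n k (λ xs → ∑[ u < m ] f u xs)
∑-∑seq-comm m n zero    f = refl
∑-∑seq-comm m n (suc k) f = trans
  (∑-comm (λ u v → ∑seq n k (λ xs → f u (v ∷ xs))))
  (sum-cong-≗ (λ v → ∑-∑seq-comm m n k (λ u xs → f u (v ∷ xs))))

∑seq-∷ʳ : ∀ (n k : ℕ) (f : List (Fin n) → ℕ) →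
  ∑seq n (suc k) f ≡ ∑seq n k (λ xs → ∑[ v < n ] f (xs ∷ʳ v))
∑seq-∷ʳ n zero    f = refl
∑seq-∷ʳ n (suc k) f = sum-cong-≗ (λ u → ∑seq-∷ʳ n k (λ xs → f (u ∷ xs)))

∑seq-reverse : ∀ (n k : ℕ) (f : List (Fin n) → ℕ) → ∑seq n k f ≡ ∑seq n k (f ∘ rev)
∑seq-reverse n zero    f = refl
∑seq-reverse n (suc k) f = begin
  ∑[ v < n ] ∑seq n k (λ xs → f (v ∷ xs))
    ≡⟨ sum-cong-≗ (λ v → ∑seq-reverse n k (λ xs → f (v ∷ xs))) ⟩
  ∑[ v < n ] ∑seq n k (λ xs → f (v ∷ rev xs))
    ≡⟨ sum-cong-≗ (λ v → ∑seq-cong n k (λ xs _ → cong f (sym (reverse-++ xs (v ∷ []))))) ⟩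
  ∑[ v < n ] ∑seq n k (λ xs → f (rev (xs ∷ʳ v)))
    ≡⟨ ∑-∑seq-comm n n k (λ v xs → f (rev (xs ∷ʳ v))) ⟩
  ∑seq n k (λ xs → ∑[ v < n ] f (rev (xs ∷ʳ v)))
    ≡⟨ sym (∑seq-∷ʳ n k (f ∘ rev)) ⟩
  ∑seq n (suc k) (f ∘ rev) ∎

distinct : ∀ {n} → List (Fin n) → Bool
distinct []       = true
distinct (x ∷ xs) = notIn x xs ∧ distinct xs

isPathSeq-K : ∀ {n} (xs : List (Fin n)) → isPathSeq (K n) xs ≡ distinct xs
isPathSeq-K []           = refl
isPathSeq-K (x ∷ [])     = refl
isPathSeq-K (x ∷ y ∷ xs) rewrite isPathSeq-K (y ∷ xs) with x ≟ y
... | yes _ = refl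
... | no _  = refl

notIn-∷ʳ : ∀ {n} (x : Fin n) xs v → notIn x (xs ∷ʳ v) ≡ notIn x xs ∧ not ⌊ x ≟ v ⌋
notIn-∷ʳ x []       v = ∧-identityʳ (not ⌊ x ≟ v ⌋)
notIn-∷ʳ x (y ∷ xs) v = trans (cong (not ⌊ x ≟ y ⌋ ∧_) (notIn-∷ʳ x xs v))
                              (sym (∧-assoc (not ⌊ x ≟ y ⌋) (notIn x xs) _))

notIn-reverse : ∀ {n} (x : Fin n) xs → notIn x (rev xs) ≡ notIn x xs
notIn-reverse x []       = refl
notIn-reverse x (y ∷ xs) = begin
  notIn x (rev (y ∷ xs))             ≡⟨ cong (notIn x) (unfold-reverse y xs) ⟩
  notIn x (rev xs ∷ʳ y)              ≡⟨ notIn-∷ʳ x (rev xs) y ⟩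
  notIn x (rev xs) ∧ not ⌊ x ≟ y ⌋   ≡⟨ cong (_∧ not ⌊ x ≟ y ⌋) (notIn-reverse x xs) ⟩
  notIn x xs ∧ not ⌊ x ≟ y ⌋         ≡⟨ ∧-comm (notIn x xs) _ ⟩
  not ⌊ x ≟ y ⌋ ∧ notIn x xs         ∎

distinct-∷ʳ : ∀ {n} (xs : List (Fin n)) v → distinct (xs ∷ʳ v) ≡ notIn v xs ∧ distinct xs
distinct-∷ʳ []       v = refl
distinct-∷ʳ (x ∷ xs) v = begin
  notIn x (xs ∷ʳ v) ∧ distinct (xs ∷ʳ v)
    ≡⟨ cong₂ _∧_ (notIn-∷ʳ x xs v) (distinct-∷ʳ xs v) ⟩
  (notIn x xs ∧ x≢v) ∧ (notIn v xs ∧ distinct xs)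
    ≡⟨ cong (_∧ (notIn v xs ∧ distinct xs)) (∧-comm (notIn x xs) x≢v) ⟩
  (x≢v ∧ notIn x xs) ∧ (notIn v xs ∧ distinct xs)
    ≡⟨ interchange x≢v (notIn x xs) (notIn v xs) (distinct xs) ⟩
  (x≢v ∧ notIn v xs) ∧ (notIn x xs ∧ distinct xs)
    ≡⟨ cong (λ b → (b ∧ notIn v xs) ∧ (notIn x xs ∧ distinct xs)) (symmetric (K _) x v) ⟩
  (not ⌊ v ≟ x ⌋ ∧ notIn v xs) ∧ (notIn x xs ∧ distinct xs) ∎
  where
  x≢v : Bool
  x≢v = not ⌊ x ≟ v ⌋

distinct-reverse : ∀ {n} (xs : List (Fin n)) → distinct (rev xs) ≡ distinct xs
distinct-reverse []       = refl
distinct-reverse (x ∷ xs) = begin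
  distinct (rev (x ∷ xs))                 ≡⟨ cong distinct (unfold-reverse x xs) ⟩
  distinct (rev xs ∷ʳ x)                  ≡⟨ distinct-∷ʳ (rev xs) x ⟩
  notIn x (rev xs) ∧ distinct (rev xs)    ≡⟨ cong₂ _∧_ (notIn-reverse x xs) (distinct-reverse xs) ⟩
  notIn x xs ∧ distinct xs                ∎

distinct-closed : ∀ {n} (x : Fin n) ms → distinct (x ∷ ms ∷ʳ x) ≡ false
distinct-closed x ms = cong (_∧ distinct (ms ∷ʳ x)) (begin
  notIn x (ms ∷ʳ x)            ≡⟨ notIn-∷ʳ x ms x ⟩
  notIn x ms ∧ not ⌊ x ≟ x ⌋   ≡⟨ cong (notIn x ms ∧_) (irrefl (K _) x) ⟩
  notIn x ms ∧ false           ≡⟨ ∧-zeroʳ (notIn x ms) ⟩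
  false                        ∎)

𝟙-notIn-∷ : ∀ {n} (v x : Fin n) xs → notIn x xs ≡ true →
  𝟙 (notIn v xs) ≡ 𝟙 (notIn v (x ∷ xs)) + 𝟙 ⌊ v ≟ x ⌋
𝟙-notIn-∷ v x xs x∉xs with v ≟ x
... | yes refl = cong 𝟙 x∉xs
... | no _     = sym (+-identityʳ _)

∑-notIn+length : ∀ {n} (xs : List (Fin n)) → distinct xs ≡ true →
  ∑[ v < n ] 𝟙 (notIn v xs) + length xs ≡ n
∑-notIn+length {n} []       _ = trans (+-identityʳ _) (∑-1 n)
∑-notIn+length {n} (x ∷ xs) x∷xs-distinct = begin
  S + suc (length xs)                     ≡⟨ sym (+-assoc S 1 (length xs)) ⟩
  S + 1 + length xs                       ≡⟨ cong (_+ length xs) removeHead ⟩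
  ∑[ v < n ] 𝟙 (notIn v xs) + length xs   ≡⟨ ∑-notIn+length xs (∧-conicalʳ _ _ x∷xs-distinct) ⟩
  n                                       ∎
  where
  S : ℕ
  S = ∑[ v < n ] 𝟙 (notIn v (x ∷ xs))
  removeHead : S + 1 ≡ ∑[ v < n ] 𝟙 (notIn v xs)
  removeHead = sym (begin
    ∑[ v < n ] 𝟙 (notIn v xs)
      ≡⟨ sum-cong-≗ (λ v → 𝟙-notIn-∷ v x xs (∧-conicalˡ _ _ x∷xs-distinct)) ⟩
    ∑[ v < n ] (𝟙 (notIn v (x ∷ xs)) + 𝟙 ⌊ v ≟ x ⌋)
      ≡⟨ ∑-distrib-+ (λ v → 𝟙 (notIn v (x ∷ xs))) (λ v → 𝟙 ⌊ v ≟ x ⌋) ⟩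
    S + ∑[ v < n ] 𝟙 ⌊ v ≟ x ⌋
      ≡⟨ cong (S +_) (∑-≟ x) ⟩
    S + 1 ∎)

∑-distinct-∷ʳ : ∀ {n} (xs : List (Fin n)) →
  ∑[ v < n ] 𝟙 (distinct (xs ∷ʳ v)) ≡ (n ∸ length xs) * 𝟙 (distinct xs)
∑-distinct-∷ʳ {n} xs = trans (sum-cong-≗ (λ v → cong 𝟙 (distinct-∷ʳ xs v))) (count (distinct xs) refl)
  where
  count : ∀ b → distinct xs ≡ b → ∑[ v < n ] 𝟙 (notIn v xs ∧ b) ≡ (n ∸ length xs) * 𝟙 b
  count false _ = begin
    ∑[ v < n ] 𝟙 (notIn v xs ∧ false)   ≡⟨ sum-cong-≗ (λ v → cong 𝟙 (∧-zeroʳ (notIn v xs))) ⟩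
    ∑[ v < n ] 0                        ≡⟨ sum-replicate-zero n ⟩
    0                                   ≡⟨ sym (*-zeroʳ (n ∸ length xs)) ⟩
    (n ∸ length xs) * 0                 ∎
  count true xs-distinct = begin
    ∑[ v < n ] 𝟙 (notIn v xs ∧ true)    ≡⟨ sum-cong-≗ (λ v → cong 𝟙 (∧-identityʳ (notIn v xs))) ⟩
    S                                   ≡⟨ sym (m+n∸n≡m S (length xs)) ⟩
    S + length xs ∸ length xs           ≡⟨ cong (_∸ length xs) (∑-notIn+length xs xs-distinct) ⟩
    n ∸ length xs                       ≡⟨ sym (*-identityʳ (n ∸ length xs)) ⟩
    (n ∸ length xs) * 1                 ∎
    where
    S : ℕ
    S = ∑[ v < n ] 𝟙 (notIn v xs)

∑seq-distinct : ∀ (n k : ℕ) → ∑seq n k (λ xs → 𝟙 (distinct xs)) ≡ n P′ k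
∑seq-distinct n zero    = refl
∑seq-distinct n (suc k) = begin
  ∑seq n (suc k) (λ xs → 𝟙 (distinct xs))
    ≡⟨ ∑seq-∷ʳ n k (λ xs → 𝟙 (distinct xs)) ⟩
  ∑seq n k (λ xs → ∑[ v < n ] 𝟙 (distinct (xs ∷ʳ v)))
    ≡⟨ ∑seq-cong n k (λ xs |xs|≡k → trans (∑-distinct-∷ʳ xs)
                                         (cong (λ l → (n ∸ l) * 𝟙 (distinct xs)) |xs|≡k)) ⟩
  ∑seq n k (λ xs → (n ∸ k) * 𝟙 (distinct xs))
    ≡⟨ sym (*-distribˡ-∑seq n k (n ∸ k) (λ xs → 𝟙 (distinct xs))) ⟩
  (n ∸ k) * ∑seq n k (λ xs → 𝟙 (distinct xs))
    ≡⟨ cong ((n ∸ k) *_) (∑seq-distinct n k) ⟩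
  (n ∸ k) * (n P′ k) ∎

length-pathsOfOrder : ∀ {n} (G : Graph n) k →
  length (pathsOfOrder G k) ≡ ∑seq n k (λ xs → 𝟙 (canonical xs ∧ isPathSeq G xs))
length-pathsOfOrder {n} G k = trans
  (length-filter-≡true (λ xs → canonical xs ∧ isPathSeq G xs) (seqs n k))
  (sum-map-seqs n k (λ xs → 𝟙 (canonical xs ∧ isPathSeq G xs)))

length-pathsOfOrder-1 : ∀ {n} (G : Graph n) → length (pathsOfOrder G 1) ≡ n
length-pathsOfOrder-1 {n} G = trans (length-pathsOfOrder G 1) (∑-1 n)

canonical-∷ʳ : ∀ {n} (x : Fin n) ms z → canonical (x ∷ ms ∷ʳ z) ≡ ⌊ toℕ x <? toℕ z ⌋
canonical-∷ʳ x []       z = refl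
canonical-∷ʳ x (m ∷ ms) z rewrite last-∷ʳ (m ∷ ms) z = refl

𝟙-<?∧+𝟙->?∧ : ∀ {n} (x z : Fin n) b → (x ≡ z → b ≡ false) →
  𝟙 (⌊ toℕ x <? toℕ z ⌋ ∧ b) + 𝟙 (⌊ toℕ z <? toℕ x ⌋ ∧ b) ≡ 𝟙 b
𝟙-<?∧+𝟙->?∧ x z b x≡z⇒¬b with toℕ x <? toℕ z | toℕ z <? toℕ x
... | yes x<z | yes z<x = ⊥-elim (<-asym x<z z<x)
... | yes _   | no _    = +-identityʳ (𝟙 b)
... | no _    | yes _   = refl
... | no x≮z  | no z≮x  =
  cong 𝟙 (sym (x≡z⇒¬b (toℕ-injective (≤-antisym (≮⇒≥ z≮x) (≮⇒≥ x≮z)))))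

𝟙-canonical+𝟙-canonical-reverse : ∀ {n} (p : List (Fin n) → Bool) →
  (∀ xs → p (rev xs) ≡ p xs) → (∀ x ms → p (x ∷ ms ∷ʳ x) ≡ false) →
  ∀ x ms z → let xs = x ∷ ms ∷ʳ z in
  𝟙 (canonical xs ∧ p xs) + 𝟙 (canonical (rev xs) ∧ p (rev xs)) ≡ 𝟙 (p xs)
𝟙-canonical+𝟙-canonical-reverse p p-reverse closed x ms z
  rewrite p-reverse (x ∷ ms ∷ʳ z)
        | reverse-∷-∷ʳ x ms z | canonical-∷ʳ x ms z | canonical-∷ʳ z (rev ms) x =
  𝟙-<?∧+𝟙->?∧ x z (p (x ∷ ms ∷ʳ z)) (λ { refl → closed x ms })

∑seq-cong-∷-∷ʳ : ∀ (n k : ℕ) (f g : List (Fin n) → ℕ) →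
  (∀ x ms z → f (x ∷ ms ∷ʳ z) ≡ g (x ∷ ms ∷ʳ z)) → ∑seq n (2 + k) f ≡ ∑seq n (2 + k) g
∑seq-cong-∷-∷ʳ n k f g f≗g = sum-cong-≗ (λ x → begin
  ∑seq n (suc k) (λ xs → f (x ∷ xs))             ≡⟨ ∑seq-∷ʳ n k (λ xs → f (x ∷ xs)) ⟩
  ∑seq n k (λ ms → ∑[ z < n ] f (x ∷ ms ∷ʳ z))   ≡⟨ ∑seq-cong n k (λ ms _ → sum-cong-≗ (f≗g x ms)) ⟩
  ∑seq n k (λ ms → ∑[ z < n ] g (x ∷ ms ∷ʳ z))   ≡⟨ ∑seq-∷ʳ n k (λ xs → g (x ∷ xs)) ⟨
  ∑seq n (suc k) (λ xs → g (x ∷ xs))             ∎)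

twice-∑seq-canonical : ∀ (n k : ℕ) (p : List (Fin n) → Bool) →
  (∀ xs → p (rev xs) ≡ p xs) → (∀ x ms → p (x ∷ ms ∷ʳ x) ≡ false) →
  2 * ∑seq n (2 + k) (λ xs → 𝟙 (canonical xs ∧ p xs)) ≡ ∑seq n (2 + k) (λ xs → 𝟙 (p xs))
twice-∑seq-canonical n k p p-reverse closed = begin
  2 * ∑seq n j c                         ≡⟨ cong (∑seq n j c +_) (*-identityˡ (∑seq n j c)) ⟩
  ∑seq n j c + ∑seq n j c                ≡⟨ cong (∑seq n j c +_) (∑seq-reverse n j c) ⟩
  ∑seq n j c + ∑seq n j (c ∘ rev)        ≡⟨ ∑seq-distrib-+ n j c (c ∘ rev) ⟨
  ∑seq n j (λ xs → c xs + c (rev xs))    ≡⟨ ∑seq-cong-∷-∷ʳ n k (λ xs → c xs + c (rev xs)) (λ xs → 𝟙 (p xs))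
                                              (𝟙-canonical+𝟙-canonical-reverse p p-reverse closed) ⟩
  ∑seq n j (λ xs → 𝟙 (p xs))             ∎
  where
  j : ℕ
  j = 2 + k
  c : List (Fin n) → ℕ
  c xs = 𝟙 (canonical xs ∧ p xs)

twice-length-pathsOfOrder-K : ∀ n k → 2 * length (pathsOfOrder (K n) (2 + k)) ≡ n P′ (2 + k)
twice-length-pathsOfOrder-K n k = begin
  2 * length (pathsOfOrder (K n) (2 + k))
    ≡⟨ cong (2 *_) (length-pathsOfOrder (K n) (2 + k)) ⟩
  2 * ∑seq n (2 + k) (λ xs → 𝟙 (canonical xs ∧ isPathSeq (K n) xs))
    ≡⟨ cong (2 *_) (∑seq-cong n (2 + k) (λ xs _ → cong (λ b → 𝟙 (canonical xs ∧ b)) (isPathSeq-K xs))) ⟩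
  2 * ∑seq n (2 + k) (λ xs → 𝟙 (canonical xs ∧ distinct xs))
    ≡⟨ twice-∑seq-canonical n k distinct distinct-reverse distinct-closed ⟩
  ∑seq n (2 + k) (λ xs → 𝟙 (distinct xs))
    ≡⟨ ∑seq-distinct n (2 + k) ⟩
  n P′ (2 + k) ∎

∑-P′-suc : ∀ n → ∑[ i < n ] (n P′ suc (toℕ i)) ≡ ∑[ i < n ] ((n ! / toℕ i !) {{toℕ i !≢0}})
∑-P′-suc n = begin
  ∑[ i < n ] (n P′ suc (toℕ i))
    ≡⟨ sum-cong-≗ {n = n} (λ i → nP′k≡n!/[n∸k]! (toℕ<n i)) ⟩
  ∑[ i < n ] ((n ! / (n ∸ suc (toℕ i)) !) {{(n ∸ suc (toℕ i)) !≢0}})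
    ≡⟨ sum-cong-≗ {n = n} (λ i → cong (λ k → (n ! / k !) {{k !≢0}}) (sym (opposite-prop i))) ⟩
  ∑[ i < n ] ((n ! / toℕ (opposite i) !) {{toℕ (opposite i) !≢0}})
    ≡⟨ ∑-permute (λ i → (n ! / toℕ i !) {{toℕ i !≢0}}) (reverse {n}) ⟨
  ∑[ i < n ] ((n ! / toℕ i !) {{toℕ i !≢0}}) ∎

mainTheorem10 : (n : ℕ) → 1 ≤ n →
    2 * pn (K n) ≡ sum (map (λ k → (n ! / k !) {{k !≢0}}) (upTo n)) + n
mainTheorem10 n@(suc m) _ = begin
  2 * pn (K n)
    ≡⟨ cong (2 *_) (sum-map-applyUpTo paths (λ k → k) n) ⟩
  2 * ∑[ i < n ] (paths (toℕ i))
    ≡⟨ *-distribˡ-sum {n = n} 2 (λ i → paths (toℕ i)) ⟩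
  2 * paths 0 + ∑[ i < m ] (2 * paths (suc (toℕ i)))
    ≡⟨ cong₂ _+_ (cong (2 *_) (length-pathsOfOrder-1 (K n)))
                 (sum-cong-≗ {n = m} (λ i → twice-length-pathsOfOrder-K n (toℕ i))) ⟩
  2 * n + S
    ≡⟨ +-assoc n (n + 0) S ⟩
  n + (n + 0 + S)
    ≡⟨ cong (λ t → n + (t + S)) (trans (+-identityʳ n) (sym (*-identityʳ n))) ⟩
  -- n * 1 is the i = 0 term n P′ 1 of the sum below
  n + (n * 1 + S)
    ≡⟨⟩
  n + ∑[ i < n ] (n P′ suc (toℕ i))
    ≡⟨ cong (n +_) (∑-P′-suc n) ⟩
  n + ∑[ i < n ] ((n ! / toℕ i !) {{toℕ i !≢0}})
    ≡⟨ +-comm n _ ⟩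
  ∑[ i < n ] ((n ! / toℕ i !) {{toℕ i !≢0}}) + n
    ≡⟨ cong (_+ n) (sum-map-applyUpTo (λ k → (n ! / k !) {{k !≢0}}) (λ k → k) n) ⟨
  sum (map (λ k → (n ! / k !) {{k !≢0}}) (upTo n)) + n ∎
  where
  paths : ℕ → ℕ
  paths k = length (pathsOfOrder (K n) (suc k))
  S : ℕ
  S = ∑[ i < m ] (n P′ (2 + toℕ i))
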